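{- Let $S(G,\sigma,M)$ be a sandpile instance with sinks, where $G$ is a connected graph on $n$ vertices and $M$ is a nonempty set of sinks. Then the number of times each vertex fires before the terminal configuration is reached is $O\big(|M|^4\cdot(\|\sigma\|_1+n)^4\big)$.
   Context: Sandpile with sinks $S(G,\sigma,M)$: $\sigma\in\mathbb{N}^{V(G)}$ gives chip counts; sinks in $M$ never fire (chips sent to them are discarded); a non-sink vertex $v$ is full if $\sigma_v\ge\deg(v)$ (degree counts all neighbors); firing it decreases $\sigma_v$ by $\deg(v)$ and adds one chip to each neighbor; a configuration is terminal if no non-sink vertex is full. For connected $G$ and nonempty $M$ the process of firing full non-sink vertices always reaches a terminal configuration, and the number of firings at each vertex is independent of the firing order. $\|\sigma\|_1=\sum_v\sigma_v$. -}

module Defs where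

open import Data.Nat using (ℕ; zero; suc; _+_; _∸_; _≤_; _<_)
open import Data.Bool using (Bool; true; false; if_then_else_)
open import Data.Fin using (Fin; _≟_)
open import Data.Fin.Subset using (Subset; _∈_; _∉_)
open import Data.Vec using (lookup)
open import Data.List using (List; []; _∷_; map; allFin)
open import Data.Nat.ListAction using (sum)
open import Data.Product using (_×_)
open import Relation.Binary.PropositionalEquality using (_≡_)
open import Relation.Nullary using (yes; no)

record Graph (n : ℕ) : Set where
  field
    adj    : Fin n → Fin n → Bool
    sym    : ∀ u v → adj u v ≡ adj v u
    irrefl : ∀ v → adj v v ≡ false
open Graph public

data Reach {n : ℕ} (G : Graph n) : Fin n → Fin n → Set where
  here : ∀ {v} → Reach G v v
  step : ∀ {u w v} → adj G u w ≡ true → Reach G w v → Reach G u v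

Connected : {n : ℕ} → Graph n → Set
Connected G = ∀ u v → Reach G u v

deg : {n : ℕ} → Graph n → Fin n → ℕ
deg {n} G v = sum (map (λ w → if adj G v w then 1 else 0) (allFin n))

Config : ℕ → Set
Config n = Fin n → ℕ

norm1 : {n : ℕ} → Config n → ℕ
norm1 {n} σ = sum (map σ (allFin n))

-- Firing vertex v in S(G,σ,M): σ_v decreases by deg v, every non-sink
-- neighbour gains one chip; chips sent to sinks are discarded.
fire : {n : ℕ} → Graph n → Subset n → Config n → Fin n → Config n
fire G M σ v w with w ≟ v
... | yes _ = σ w ∸ deg G v
... | no  _ = σ w + (if adj G v w then (if lookup M w then 0 else 1) else 0)

Full : {n : ℕ} → Graph n → Subset n → Config n → Fin n → Set
Full G M σ v = (v ∉ M) × (deg G v ≤ σ v)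

Terminal : {n : ℕ} → Graph n → Subset n → Config n → Set
Terminal G M σ = ∀ v → v ∉ M → σ v < deg G v

data Run {n : ℕ} (G : Graph n) (M : Subset n) : Config n → List (Fin n) → Config n → Set where
  done : ∀ {σ} → Run G M σ [] σ
  fireStep : ∀ {σ v vs τ} → Full G M σ v → Run G M (fire G M σ v) vs τ → Run G M σ (v ∷ vs) τ

timesFired : {n : ℕ} → Fin n → List (Fin n) → ℕ
timesFired v [] = 0
timesFired v (w ∷ ws) with w ≟ v
... | yes _ = suc (timesFired v ws)
... | no  _ = timesFired v ws

-- Write x v for the number of times v fires. Counting chips at each vertex, for
-- any set S of non-sink vertices the chips carried out of S along its boundary
-- edges are at most the ‖σ‖₁ chips present initially plus the chips carried into
-- S. For 1 ≤ t ≤ x v take S = {w : t ≤ x w}: it avoids the sinks, which never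
-- fire, and by connectivity it has boundary edges, so the inequality produces a
-- boundary edge w → u with x u < t ≤ x w ≤ x u + ‖σ‖₁. Descending from x v in
-- steps of ‖σ‖₁, each step therefore enlarges the superlevel set {w : t ≤ x w};
-- it has at most n elements, so x v ≤ n ‖σ‖₁ ≤ |M|⁴ (‖σ‖₁ + n)⁴.
module Submission where

open import Defs renaming (sym to adj-sym)

open import Data.Nat
  using (ℕ; zero; suc; _+_; _*_; _∸_; _^_; _≤_; _<_; _≤?_; z≤n; s≤s; NonZero; >-nonZero)
open import Data.Nat.Properties hiding (_≟_)
open import Data.Bool using (Bool; true; false; not; if_then_else_)
open import Data.Fin using (Fin; zero; suc; _≟_)
open import Data.List using (List; []; _∷_; map; allFin; tabulate)
open import Data.List.Properties using (map-tabulate)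
open import Data.Nat.ListAction using (sum)
open import Data.Product using (∃; ∃₂; _×_; _,_)
open import Function using (_∘_; id)
open import Level using (0ℓ)
open import Relation.Unary using (Pred; Decidable)
open import Relation.Binary.PropositionalEquality
open import Relation.Nullary using (does; yes; no; ¬_; contradiction)
open import Relation.Nullary.Decidable using (dec-true; dec-false)
open import Data.Fin.Subset using (Subset; _∈_; _∉_; Nonempty; ∣_∣)
open import Data.Fin.Subset.Properties using (x∈p⇒∣p-x∣<∣p∣)
open import Data.Vec using (lookup)
open import Data.Vec.Properties using (lookup⇒[]=)
open import Data.Nat.Tactic.RingSolver using (solve-∀)
import Algebra.Properties.CommutativeSemigroup as CommSemigroupProperties
open CommSemigroupProperties +-commutativeSemigroup using ()
  renaming (x∙yz≈y∙xz to +-left-comm; xy∙z≈xz∙y to +-right-comm)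
open CommSemigroupProperties *-commutativeSemigroup using ()
  renaming (x∙yz≈y∙xz to *-left-comm)
open import Algebra.Properties.Semiring.Sum +-*-semiring
  using (∑-distrib-+; ∑-comm; *-distribˡ-sum; sum-cong-≗; sum-replicate-zero)
  renaming (sum to ∑)

χ : Bool → ℕ
χ b = if b then 1 else 0

sum-map-allFin : ∀ {n} (f : Fin n → ℕ) → sum (map f (allFin n)) ≡ ∑ f
sum-map-allFin f = trans (cong sum (map-tabulate id f)) (sum-tabulate f)
  where
  sum-tabulate : ∀ {m} (g : Fin m → ℕ) → sum (tabulate g) ≡ ∑ g
  sum-tabulate {zero} g = refl
  sum-tabulate {suc m} g = cong (g zero +_) (sum-tabulate (g ∘ suc))

∑-+-* : ∀ {n} (f : Fin n → ℕ) c g → ∑ (λ i → f i + c * g i) ≡ ∑ f + c * ∑ g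
∑-+-* f c g = trans (∑-distrib-+ f (λ i → c * g i)) (cong (∑ f +_) (sym (*-distribˡ-sum c g)))

∑-mono-≤ : ∀ {n} {f g : Fin n → ℕ} → (∀ i → f i ≤ g i) → ∑ f ≤ ∑ g
∑-mono-≤ {zero} f≤g = z≤n
∑-mono-≤ {suc n} f≤g = +-mono-≤ (f≤g zero) (∑-mono-≤ (f≤g ∘ suc))

∑-mono-< : ∀ {n} {f g : Fin n → ℕ} → (∀ i → f i ≤ g i) → ∀ i → f i < g i → ∑ f < ∑ g
∑-mono-< f≤g zero fi<gi = +-mono-<-≤ fi<gi (∑-mono-≤ (f≤g ∘ suc))
∑-mono-< f≤g (suc i) fi<gi = +-mono-≤-< (f≤g zero) (∑-mono-< (f≤g ∘ suc) i fi<gi)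

term≤∑ : ∀ {n} (f : Fin n → ℕ) i → f i ≤ ∑ f
term≤∑ f zero = m≤m+n _ _
term≤∑ f (suc i) = ≤-trans (term≤∑ (f ∘ suc) i) (m≤n+m _ _)

∑<∑⇒∃< : ∀ {n} (f g : Fin n → ℕ) → ∑ f < ∑ g → ∃ λ i → f i < g i
∑<∑⇒∃< {zero} f g ()
∑<∑⇒∃< {suc n} f g ∑f<∑g with f zero <? g zero
... | yes f0<g0 = zero , f0<g0
... | no f0≮g0 with ∑<∑⇒∃< (f ∘ suc) (g ∘ suc) tail<
  where
  tail< : ∑ (f ∘ suc) < ∑ (g ∘ suc)
  tail< = +-cancelˡ-< (g zero) _ _ (≤-<-trans (+-monoˡ-≤ _ (≮⇒≥ f0≮g0)) ∑f<∑g)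
...   | i , fi<gi = suc i , fi<gi

m*o<n*o⇒o≢0 : ∀ m n o → m * o < n * o → o ≢ 0
m*o<n*o⇒o≢0 m n o lt refl = <-irrefl (trans (*-zeroʳ m) (sym (*-zeroʳ n))) lt

∑χ≤n : ∀ {n} (b : Fin n → Bool) → ∑ (χ ∘ b) ≤ n
∑χ≤n {zero} b = z≤n
∑χ≤n {suc n} b = +-mono-≤ (χ≤1 (b zero)) (∑χ≤n (b ∘ suc))
  where
  χ≤1 : ∀ c → χ c ≤ 1
  χ≤1 true = ≤-refl
  χ≤1 false = z≤n

∑∑ : ∀ {n} → (Fin n → Fin n → ℕ) → ℕ
∑∑ f = ∑ λ w → ∑ (f w)

δ : ∀ {n} → Fin n → Fin n → ℕ
δ v u = χ (does (v ≟ u))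

∑-δ : ∀ {n} v (f : Fin n → ℕ) → ∑ (λ u → δ v u * f u) ≡ f v
∑-δ {suc n} zero f rewrite sum-replicate-zero n | +-identityʳ (f zero) = +-identityʳ (f zero)
∑-δ (suc v) f = ∑-δ v (f ∘ suc)

superlevel : ∀ {n} → (Fin n → ℕ) → ℕ → ℕ
superlevel x t = ∑ λ w → χ (does (t ≤? x w))

superlevel≤n : ∀ {n} (x : Fin n → ℕ) t → superlevel x t ≤ n
superlevel≤n x t = ∑χ≤n (λ w → does (t ≤? x w))

superlevel-antitone : ∀ {t t′} y → t′ ≤ t → χ (does (t ≤? y)) ≤ χ (does (t′ ≤? y))
superlevel-antitone {t} {t′} y t′≤t with t ≤? y
... | no t≰y rewrite dec-false (t ≤? y) t≰y = z≤n
... | yes t≤y rewrite dec-true (t ≤? y) t≤y | dec-true (t′ ≤? y) (≤-trans t′≤t t≤y) = ≤-refl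

superlevel-step : ∀ {n} (x : Fin n → ℕ) {N t} u → x u < t → t ≤ x u + N →
  suc (superlevel x t) ≤ superlevel x (t ∸ N)
superlevel-step x {N} {t} u xu<t t≤xu+N =
  ∑-mono-< (λ w → superlevel-antitone (x w) (m∸n≤m t N)) u strict
  where
  strict : χ (does (t ≤? x u)) < χ (does (t ∸ N ≤? x u))
  strict rewrite dec-false (t ≤? x u) (<⇒≱ xu<t)
               | dec-true (t ∸ N ≤? x u) (m≤n+o⇒m∸n≤o t N (≤-trans t≤xu+N (≤-reflexive (+-comm (x u) N))))
               = ≤-refl

GapsAtMost : ∀ {n} → ℕ → (Fin n → ℕ) → ℕ → Set
GapsAtMost N x h = ∀ t → 1 ≤ t → t ≤ h → ∃ λ u → x u < t × t ≤ x u + N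

gapsAtMost⇒≤n*N : ∀ {n} N (x : Fin n → ℕ) v → GapsAtMost N x (x v) → x v ≤ n * N
gapsAtMost⇒≤n*N {n} N x v gaps with x v ≤? n * N
... | yes bounded = bounded
... | no unbounded = contradiction (superlevel≤n x (x v ∸ n * N)) (<⇒≱ (descend n (≰⇒> unbounded)))
  where
  descend : ∀ k → k * N < x v → suc k ≤ superlevel x (x v ∸ k * N)
  descend zero _ = ≤-trans (≤-reflexive (cong χ (sym (dec-true (x v ≤? x v) ≤-refl)))) (term≤∑ _ v)
  descend (suc k) sk*N<xv =
    let (u , below , within) = gaps t (m<n⇒0<n∸m k*N<xv) (m∸n≤m (x v) (k * N)) in
    begin
      suc (suc k)                ≤⟨ s≤s (descend k k*N<xv) ⟩
      suc (superlevel x t)       ≤⟨ superlevel-step x u below within ⟩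
      superlevel x (t ∸ N)       ≡⟨ cong (superlevel x) (∸-+-assoc (x v) (k * N) N) ⟩
      superlevel x (x v ∸ (k * N + N)) ≡⟨ cong (λ s → superlevel x (x v ∸ s)) (+-comm (k * N) N) ⟩
      superlevel x (x v ∸ suc k * N) ∎
    where
    open ≤-Reasoning
    t : ℕ
    t = x v ∸ k * N
    k*N<xv : k * N < x v
    k*N<xv = ≤-<-trans (m≤n+m (k * N) N) sk*N<xv

square≤fourth-power : ∀ p → p * p ≤ p ^ 4
square≤fourth-power zero = z≤n
square≤fourth-power p@(suc _) = ≤-trans (m≤m*n (p * p) (p * p)) (≤-reflexive (square-of-square p))
  where
  square-of-square : ∀ p → (p * p) * (p * p) ≡ p * (p * (p * (p * 1)))
  square-of-square = solve-∀

m*n≤k⁴*[n+m]⁴ : ∀ k .{{_ : NonZero k}} m n → m * n ≤ k ^ 4 * (n + m) ^ 4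
m*n≤k⁴*[n+m]⁴ k m n = begin
  m * n               ≤⟨ *-mono-≤ (m≤n+m m n) (m≤m+n n m) ⟩
  (n + m) * (n + m)   ≤⟨ square≤fourth-power (n + m) ⟩
  (n + m) ^ 4         ≤⟨ m≤n*m ((n + m) ^ 4) (k ^ 4) {{m^n≢0 k 4}} ⟩
  k ^ 4 * (n + m) ^ 4 ∎
  where open ≤-Reasoning

adjacency : ∀ {n} → Graph n → Fin n → Fin n → ℕ
adjacency G u w = χ (adj G u w)

deg≡∑adjacency : ∀ {n} (G : Graph n) v → deg G v ≡ ∑ (adjacency G v)
deg≡∑adjacency G v = sum-map-allFin (adjacency G v)

timesFired-∷ : ∀ {n} (v u : Fin n) vs → timesFired u (v ∷ vs) ≡ δ v u + timesFired u vs
timesFired-∷ v u vs with v ≟ u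
... | yes _ = refl
... | no _ = refl

∑-timesFired-∷ : ∀ {n} (v : Fin n) vs (f : Fin n → ℕ) →
  ∑ (λ u → timesFired u (v ∷ vs) * f u) ≡ f v + ∑ (λ u → timesFired u vs * f u)
∑-timesFired-∷ v vs f = begin
  ∑ (λ u → timesFired u (v ∷ vs) * f u)
    ≡⟨ sum-cong-≗ (λ u → cong (_* f u) (timesFired-∷ v u vs)) ⟩
  ∑ (λ u → (δ v u + timesFired u vs) * f u)
    ≡⟨ sum-cong-≗ (λ u → *-distribʳ-+ (f u) (δ v u) (timesFired u vs)) ⟩
  ∑ (λ u → δ v u * f u + timesFired u vs * f u)
    ≡⟨ ∑-distrib-+ (λ u → δ v u * f u) (λ u → timesFired u vs * f u) ⟩
  ∑ (λ u → δ v u * f u) + ∑ (λ u → timesFired u vs * f u)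
    ≡⟨ cong (_+ ∑ (λ u → timesFired u vs * f u)) (∑-δ v f) ⟩
  f v + ∑ (λ u → timesFired u vs * f u) ∎
  where open ≡-Reasoning

∉⇒lookup≡false : ∀ {n} {M : Subset n} {w} → w ∉ M → lookup M w ≡ false
∉⇒lookup≡false {M = M} {w} w∉M with lookup M w in eq
... | false = refl
... | true = contradiction (lookup⇒[]= w M eq) w∉M

sinks-never-fire : ∀ {n} {G : Graph n} {M σ vs τ w} →
  Run G M σ vs τ → w ∈ M → timesFired w vs ≡ 0
sinks-never-fire done w∈M = refl
sinks-never-fire {w = w} (fireStep {v = v} (v∉M , _) r) w∈M with v ≟ w
... | yes refl = contradiction w∈M v∉M
... | no _ = sinks-never-fire r w∈M

fire-balance : ∀ {n} (G : Graph n) M σ {v w} → w ∉ M → deg G v ≤ σ v →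
  fire G M σ v w + δ v w * deg G w ≡ σ w + adjacency G v w
fire-balance G M σ {v} {w} w∉M dv with w ≟ v | v ≟ w
... | yes refl | yes _ rewrite irrefl G w | +-identityʳ (deg G w) | +-identityʳ (σ w) =
  m∸n+n≡m dv
... | yes refl | no w≢w = contradiction refl w≢w
... | no w≢v | yes refl = contradiction refl w≢v
... | no _ | no _ rewrite ∉⇒lookup≡false w∉M = +-identityʳ _

chip-balance : ∀ {n} {G : Graph n} {M σ vs τ w} → Run G M σ vs τ → w ∉ M →
  τ w + timesFired w vs * deg G w ≡ σ w + ∑ (λ u → timesFired u vs * adjacency G u w)
chip-balance {n} {σ = σ} {w = w} done w∉M = cong (σ w +_) (sym (sum-replicate-zero n))
chip-balance {G = G} {M} {σ} {v ∷ vs} {τ} {w} (fireStep (_ , dv) r) w∉M = begin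
  τ w + timesFired w (v ∷ vs) * d
    ≡⟨ cong (λ k → τ w + k * d) (timesFired-∷ v w vs) ⟩
  τ w + (δ v w + x w) * d
    ≡⟨ distrib-shuffle (τ w) (δ v w) (x w) d ⟩
  (τ w + x w * d) + δ v w * d
    ≡⟨ cong (_+ δ v w * d) (chip-balance r w∉M) ⟩
  (fire G M σ v w + inflow) + δ v w * d
    ≡⟨ +-right-comm (fire G M σ v w) inflow (δ v w * d) ⟩
  (fire G M σ v w + δ v w * d) + inflow
    ≡⟨ cong (_+ inflow) (fire-balance G M σ w∉M dv) ⟩
  (σ w + adjacency G v w) + inflow
    ≡⟨ +-assoc (σ w) _ _ ⟩
  σ w + (adjacency G v w + inflow)
    ≡⟨ cong (σ w +_) (∑-timesFired-∷ v vs (λ u → adjacency G u w)) ⟨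
  σ w + ∑ (λ u → timesFired u (v ∷ vs) * adjacency G u w) ∎
  where
  open ≡-Reasoning
  d : ℕ
  d = deg G w
  x : Fin _ → ℕ
  x u = timesFired u vs
  inflow : ℕ
  inflow = ∑ (λ u → x u * adjacency G u w)
  distrib-shuffle : ∀ t a b c → t + (a + b) * c ≡ (t + b * c) + a * c
  distrib-shuffle = solve-∀

split-by-χ : ∀ s y a b → s * (y * a) ≡ y * (s * (χ b * a)) + y * (s * (χ (not b) * a))
split-by-χ s y a true = lemma s y a
  where
  lemma : ∀ s y a → s * (y * a) ≡ y * (s * (1 * a)) + y * (s * (0 * a))
  lemma = solve-∀
split-by-χ s y a false = lemma s y a
  where
  lemma : ∀ s y a → s * (y * a) ≡ y * (s * (0 * a)) + y * (s * (1 * a))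
  lemma = solve-∀

module Cut {n} {G : Graph n} {M : Subset n} {σ vs τ} (run : Run G M σ vs τ)
           {S : Pred (Fin n) 0ℓ} (S? : Decidable S) (S∩M≡∅ : ∀ {w} → S w → w ∉ M) where

  x : Fin n → ℕ
  x u = timesFired u vs

  inS outS : Fin n → ℕ
  inS w = χ (does (S? w))
  outS w = χ (not (does (S? w)))

  internal leaving : Fin n → Fin n → ℕ
  internal w u = inS w * (inS u * adjacency G w u)
  leaving w u = inS w * (outS u * adjacency G w u)

  sent received : Fin n → ℕ
  sent w = inS w * (x w * deg G w)
  received w = inS w * ∑ (λ u → x u * adjacency G u w)

  exported imported internalFlow : ℕ
  exported = ∑∑ (λ w u → x w * leaving w u)
  imported = ∑∑ (λ w u → x u * leaving w u)
  internalFlow = ∑∑ (λ w u → x w * internal w u)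

  ∑sent≤chips+∑received : ∑ sent ≤ norm1 σ + ∑ received
  ∑sent≤chips+∑received = begin
    ∑ sent                        ≤⟨ ∑-mono-≤ sent≤chips+received ⟩
    ∑ (λ w → σ w + received w)    ≡⟨ ∑-distrib-+ σ received ⟩
    ∑ σ + ∑ received              ≡⟨ cong (_+ ∑ received) (sum-map-allFin σ) ⟨
    norm1 σ + ∑ received          ∎
    where
    open ≤-Reasoning
    sent≤chips+received : ∀ w → sent w ≤ σ w + received w
    sent≤chips+received w with S? w
    ... | no _ = z≤n
    ... | yes w∈S
      rewrite +-identityʳ (x w * deg G w) | +-identityʳ (∑ (λ u → x u * adjacency G u w)) =
      ≤-trans (m≤n+m _ (τ w)) (≤-reflexive (chip-balance run (S∩M≡∅ w∈S)))

  ∑sent≡internalFlow+exported : ∑ sent ≡ internalFlow + exported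
  ∑sent≡internalFlow+exported = trans (sum-cong-≗ sent≡)
    (∑-distrib-+ (λ w → ∑ (λ u → x w * internal w u)) (λ w → ∑ (λ u → x w * leaving w u)))
    where
    open ≡-Reasoning
    sent≡ : ∀ w → sent w ≡ ∑ (λ u → x w * internal w u) + ∑ (λ u → x w * leaving w u)
    sent≡ w = begin
      inS w * (x w * deg G w)
        ≡⟨ cong (λ d → inS w * (x w * d)) (deg≡∑adjacency G w) ⟩
      inS w * (x w * ∑ (adjacency G w))
        ≡⟨ cong (inS w *_) (*-distribˡ-sum (x w) (adjacency G w)) ⟩
      inS w * ∑ (λ u → x w * adjacency G w u)
        ≡⟨ *-distribˡ-sum (inS w) (λ u → x w * adjacency G w u) ⟩
      ∑ (λ u → inS w * (x w * adjacency G w u))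
        ≡⟨ sum-cong-≗ (λ u → split-by-χ (inS w) (x w) _ (does (S? u))) ⟩
      ∑ (λ u → x w * internal w u + x w * leaving w u)
        ≡⟨ ∑-distrib-+ (λ u → x w * internal w u) (λ u → x w * leaving w u) ⟩
      ∑ (λ u → x w * internal w u) + ∑ (λ u → x w * leaving w u) ∎

  ∑received≡internalFlow+imported : ∑ received ≡ internalFlow + imported
  ∑received≡internalFlow+imported = begin
    ∑ received
      ≡⟨ sum-cong-≗ received≡ ⟩
    ∑ (λ w → ∑ (λ u → x u * internal w u) + ∑ (λ u → x u * leaving w u))
      ≡⟨ ∑-distrib-+ (λ w → ∑ (λ u → x u * internal w u)) (λ w → ∑ (λ u → x u * leaving w u)) ⟩
    ∑∑ (λ w u → x u * internal w u) + imported
      ≡⟨ cong (_+ imported) internal-swap ⟩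
    internalFlow + imported ∎
    where
    open ≡-Reasoning
    received≡ : ∀ w → received w ≡ ∑ (λ u → x u * internal w u) + ∑ (λ u → x u * leaving w u)
    received≡ w = begin
      inS w * ∑ (λ u → x u * adjacency G u w)
        ≡⟨ *-distribˡ-sum (inS w) (λ u → x u * adjacency G u w) ⟩
      ∑ (λ u → inS w * (x u * adjacency G u w))
        ≡⟨ sum-cong-≗ (λ u → cong (λ b → inS w * (x u * χ b)) (adj-sym G u w)) ⟩
      ∑ (λ u → inS w * (x u * adjacency G w u))
        ≡⟨ sum-cong-≗ (λ u → split-by-χ (inS w) (x u) _ (does (S? u))) ⟩
      ∑ (λ u → x u * internal w u + x u * leaving w u)
        ≡⟨ ∑-distrib-+ (λ u → x u * internal w u) (λ u → x u * leaving w u) ⟩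
      ∑ (λ u → x u * internal w u) + ∑ (λ u → x u * leaving w u) ∎
    internal-sym : ∀ w u → internal w u ≡ internal u w
    internal-sym w u rewrite adj-sym G w u = *-left-comm (inS w) (inS u) _
    internal-swap : ∑∑ (λ w u → x u * internal w u) ≡ internalFlow
    internal-swap = trans (∑-comm (λ w u → x u * internal w u))
                          (sum-cong-≗ λ u → sum-cong-≗ λ w → cong (x u *_) (internal-sym w u))

  exported≤chips+imported : exported ≤ norm1 σ + imported
  exported≤chips+imported = +-cancelˡ-≤ internalFlow exported (norm1 σ + imported) (begin
    internalFlow + exported               ≡⟨ ∑sent≡internalFlow+exported ⟨
    ∑ sent                                ≤⟨ ∑sent≤chips+∑received ⟩
    norm1 σ + ∑ received                  ≡⟨ cong (norm1 σ +_) ∑received≡internalFlow+imported ⟩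
    norm1 σ + (internalFlow + imported)   ≡⟨ +-left-comm (norm1 σ) internalFlow imported ⟩
    internalFlow + (norm1 σ + imported)   ∎)
    where open ≤-Reasoning

  leaving≡1 : ∀ {w u} → S w → ¬ S u → adj G w u ≡ true → leaving w u ≡ 1
  leaving≡1 {w} {u} w∈S u∉S w~u
    rewrite dec-true (S? w) w∈S | dec-false (S? u) u∉S | w~u = refl

  leaving≢0 : ∀ {w u} → leaving w u ≢ 0 → S w × ¬ S u
  leaving≢0 {w} {u} L≢0 with S? w | S? u
  ... | yes w∈S | no u∉S = w∈S , u∉S
  ... | yes _   | yes _  = contradiction refl L≢0
  ... | no _    | _      = contradiction refl L≢0

  reach⇒leaving-edge : ∀ {a b} → Reach G a b → S a → ¬ S b → ∃₂ λ w u → leaving w u ≡ 1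
  reach⇒leaving-edge here a∈S a∉S = contradiction a∈S a∉S
  reach⇒leaving-edge {a} (step {w = c} a~c c⇝b) a∈S b∉S with S? c
  ... | yes c∈S = reach⇒leaving-edge c⇝b c∈S b∉S
  ... | no c∉S = a , c , leaving≡1 a∈S c∉S a~c

  reach⇒∑∑leaving≥1 : ∀ {a b} → Reach G a b → S a → ¬ S b → 1 ≤ ∑∑ leaving
  reach⇒∑∑leaving≥1 a⇝b a∈S b∉S with reach⇒leaving-edge a⇝b a∈S b∉S
  ... | w , u , L≡1 = begin
    1                          ≡⟨ L≡1 ⟨
    leaving w u                ≤⟨ term≤∑ (leaving w) u ⟩
    ∑ (leaving w)              ≤⟨ term≤∑ (λ w → ∑ (leaving w)) w ⟩
    ∑∑ leaving                 ∎
    where open ≤-Reasoning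

  raised : Fin n → Fin n → ℕ
  raised w u = (x u + suc (norm1 σ)) * leaving w u

  ∑∑raised : ∑∑ raised ≡ imported + suc (norm1 σ) * ∑∑ leaving
  ∑∑raised = trans (sum-cong-≗ row)
    (∑-+-* (λ w → ∑ λ u → x u * leaving w u) (suc (norm1 σ)) (λ w → ∑ (leaving w)))
    where
    row : ∀ w → ∑ (raised w) ≡ ∑ (λ u → x u * leaving w u) + suc (norm1 σ) * ∑ (leaving w)
    row w = trans (sum-cong-≗ λ u → *-distribʳ-+ (leaving w u) (x u) (suc (norm1 σ)))
                  (∑-+-* (λ u → x u * leaving w u) (suc (norm1 σ)) (leaving w))

  exported<∑∑raised : 1 ≤ ∑∑ leaving → exported < ∑∑ raised
  exported<∑∑raised K≥1 = begin-strict
    exported                                  ≤⟨ exported≤chips+imported ⟩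
    norm1 σ + imported                        <⟨ +-monoˡ-< imported chips<sucChips*K ⟩
    suc (norm1 σ) * ∑∑ leaving + imported     ≡⟨ +-comm _ imported ⟩
    imported + suc (norm1 σ) * ∑∑ leaving     ≡⟨ ∑∑raised ⟨
    ∑∑ raised                                 ∎
    where
    open ≤-Reasoning
    chips<sucChips*K : norm1 σ < suc (norm1 σ) * ∑∑ leaving
    chips<sucChips*K = ≤-trans (≤-reflexive (sym (*-identityʳ _))) (*-monoʳ-≤ (suc (norm1 σ)) K≥1)

  -- If every leaving edge w → u had x w > x u + ‖σ‖₁, exported would exceed
  -- ‖σ‖₁ + imported; comparing the sums termwise yields a short one instead.
  short-leaving-edge : ∀ {a b} → Reach G a b → S a → ¬ S b →
    ∃₂ λ w u → S w × ¬ S u × x w ≤ x u + norm1 σ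
  short-leaving-edge a⇝b a∈S b∉S
    with ∑<∑⇒∃< (λ w → ∑ λ u → x w * leaving w u) (λ w → ∑ (raised w))
                (exported<∑∑raised (reach⇒∑∑leaving≥1 a⇝b a∈S b∉S))
  ... | w , row< with ∑<∑⇒∃< (λ u → x w * leaving w u) (raised w) row<
  ...   | u , entry< with leaving≢0 (m*o<n*o⇒o≢0 (x w) (x u + suc (norm1 σ)) _ entry<)
  ...     | w∈S , u∉S = w , u , w∈S , u∉S , ≤-pred (begin
    suc (x w)                   ≤⟨ *-cancelʳ-< (leaving w u) (x w) (x u + suc (norm1 σ)) entry< ⟩
    x u + suc (norm1 σ)         ≡⟨ +-suc (x u) (norm1 σ) ⟩
    suc (x u + norm1 σ)         ∎)
    where open ≤-Reasoning

firing-gaps : ∀ {n} {G : Graph n} {M σ vs τ m} → Connected G → m ∈ M → Run G M σ vs τ →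
  ∀ v → GapsAtMost (norm1 σ) (λ w → timesFired w vs) (timesFired v vs)
firing-gaps {M = M} {σ} {vs} {m = m} conn m∈M run v t 1≤t t≤xv =
  let (_ , u , t≤xw , t≰xu , xw≤xu+N) =
        Cut.short-leaving-edge run (λ w → t ≤? x w) sinks-below-t
          (conn v m) t≤xv (λ t≤xm → sinks-below-t t≤xm m∈M)
  in u , ≰⇒> t≰xu , ≤-trans t≤xw xw≤xu+N
  where
  x : Fin _ → ℕ
  x w = timesFired w vs
  sinks-below-t : ∀ {w} → t ≤ x w → w ∉ M
  sinks-below-t t≤xw w∈M = <⇒≱ 1≤t (subst (t ≤_) (sinks-never-fire run w∈M) t≤xw)

firings≤n*chips : ∀ {n} {G : Graph n} {M σ vs τ m} → Connected G → m ∈ M → Run G M σ vs τ →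
  ∀ v → timesFired v vs ≤ n * norm1 σ
firings≤n*chips {σ = σ} {vs} conn m∈M run v =
  gapsAtMost⇒≤n*N (norm1 σ) (λ w → timesFired w vs) v (firing-gaps conn m∈M run v)

lemmaA4 : ∃ λ (C : ℕ) →
    ∀ (n : ℕ) (G : Graph n) (σ : Config n) (M : Subset n) →
    Connected G → Nonempty M →
    ∀ (vs : List (Fin n)) (τ : Config n) → Run G M σ vs τ → Terminal G M τ →
    ∀ (v : Fin n) → timesFired v vs ≤ C * (∣ M ∣ ^ 4 * (norm1 σ + n) ^ 4)
lemmaA4 = 1 , λ n G σ M conn (m , m∈M) vs τ run _ v →
  let instance _ = >-nonZero (m<n⇒0<n (x∈p⇒∣p-x∣<∣p∣ m∈M)) in
  begin
    timesFired v vs                  ≤⟨ firings≤n*chips conn m∈M run v ⟩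
    n * norm1 σ                      ≤⟨ m*n≤k⁴*[n+m]⁴ ∣ M ∣ n (norm1 σ) ⟩
    ∣ M ∣ ^ 4 * (norm1 σ + n) ^ 4     ≡⟨ *-identityˡ _ ⟨
    1 * (∣ M ∣ ^ 4 * (norm1 σ + n) ^ 4) ∎
  where open ≤-Reasoning
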